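{- For every finite digraph $G$, if $\nu\le 2$ then $\phi_m(G)\le 4$.
   Context: $\nu$ is the maximum number of vertex-disjoint directed cycles of $G$ (loops count as cycles). A Boolean network $f:\{0,1\}^n\to\{0,1\}^n$ is monotone if $x\le y\Rightarrow f(x)\le f(y)$; its interaction graph is the digraph on $[n]$ with arc $uv$ (loops allowed) iff $f_v$ depends on $x_u$; $\phi_m(G)$ is the maximum number of fixed points of a monotone Boolean network whose interaction graph is isomorphic to $G$. -}

module Defs where

open import Data.Nat using (ℕ; zero; suc; _+_)
open import Data.Bool using (Bool; true; false; not; T; _≤_)
open import Data.Bool.Properties using () renaming (_≟_ to _≟ᵇ_)
open import Data.Fin using (Fin)
open import Data.Fin.Permutation using (Permutation′; _⟨$⟩ʳ_)
open import Data.Vec using (Vec; []; _∷_; lookup; updateAt)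
open import Data.Vec.Properties using (≡-dec)
open import Data.List using (List; []; _∷_; _++_; [_]; length; filter; concatMap)
open import Data.List.Membership.Propositional using (_∈_)
open import Data.List.Relation.Unary.Unique.Propositional using (Unique)
open import Data.List.Relation.Unary.AllPairs using (AllPairs)
open import Data.Product using (Σ; ∃; _×_; _,_)
open import Data.Unit using (⊤)
open import Data.Empty using (⊥)
open import Relation.Nullary using (¬_)
open import Relation.Binary.PropositionalEquality using (_≡_; _≢_)
open import Function.Bundles using (_⇔_)

-- Finite digraphs on vertex set Fin n (loops allowed); arc u v iff G u v = true

Digraph : ℕ → Set
Digraph n = Fin n → Fin n → Bool

Arc : ∀ {n} → Digraph n → Fin n → Fin n → Set
Arc G u v = T (G u v)

Chain : ∀ {n} → Digraph n → List (Fin n) → Set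
Chain G []            = ⊤
Chain G (x ∷ [])      = ⊤
Chain G (x ∷ y ∷ rest) = Arc G x y × Chain G (y ∷ rest)

-- A directed cycle: a nonempty list of distinct vertices v₀ … v_{k-1}
-- with arcs v_i → v_{i+1} and v_{k-1} → v₀ (k = 1 gives a loop).
record Cycle {n : ℕ} (G : Digraph n) : Set where
  field
    start  : Fin n
    rest   : List (Fin n)
    unique : Unique (start ∷ rest)
    closed : Chain G (start ∷ rest ++ [ start ])

vertices : ∀ {n} {G : Digraph n} → Cycle G → List (Fin n)
vertices c = Cycle.start c ∷ Cycle.rest c

VertexDisjoint : ∀ {n} {G : Digraph n} → Cycle G → Cycle G → Set
VertexDisjoint {n} c d = (x : Fin n) → x ∈ vertices c → x ∈ vertices d → ⊥

HasDisjointCycles : ∀ {n} → Digraph n → ℕ → Set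
HasDisjointCycles G k =
  Σ (List (Cycle G)) λ cs → length cs ≡ k × AllPairs VertexDisjoint cs

-- ν(G) ≤ k  (ν = maximum number of vertex-disjoint cycles)
ν≤ : ∀ {n} → Digraph n → ℕ → Set
ν≤ G k = ¬ HasDisjointCycles G (suc k)

BN : ℕ → Set
BN n = Vec Bool n → Vec Bool n

_≤ᵛ_ : ∀ {n} → Vec Bool n → Vec Bool n → Set
x ≤ᵛ y = ∀ i → lookup x i ≤ lookup y i

Monotone : ∀ {n} → BN n → Set
Monotone f = ∀ x y → x ≤ᵛ y → f x ≤ᵛ f y

DependsOn : ∀ {n} → BN n → Fin n → Fin n → Set
DependsOn f u v = ∃ λ x → lookup (f x) v ≢ lookup (f (updateAt x u not)) v

IGIsomorphic : ∀ {n} → BN n → Digraph n → Set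
IGIsomorphic {n} f G =
  Σ (Permutation′ n) λ σ → ∀ u v → Arc G u v ⇔ DependsOn f (σ ⟨$⟩ʳ u) (σ ⟨$⟩ʳ v)

allConfigs : (n : ℕ) → List (Vec Bool n)
allConfigs zero    = [] ∷ []
allConfigs (suc n) = concatMap (λ x → (false ∷ x) ∷ (true ∷ x) ∷ []) (allConfigs n)

numFixedPoints : ∀ {n} → BN n → ℕ
numFixedPoints {n} f = length (filter (λ x → ≡-dec _≟ᵇ_ (f x) x) (allConfigs n))

-- For fixed points x, y of a monotone network f with y ≰ x, every vertex v of the
-- set {v : x_v < y_v} has an in-neighbour in that set: f_v takes the value 1 at y
-- and 0 at the meet y ∧ x ≤ x, so some coordinate where y and y ∧ x differ
-- influences f_v. Hence the set carries a cycle of the interaction graph. When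
-- y ≤ z, the sets of (x, y) and (z, w) are disjoint, so it suffices to find, among
-- any five distinct fixed points, three such pairs pairwise related in this way.
-- This holds in every poset: a strict comparison u < v where u is not least and v
-- is not greatest extends to three chained pairs; otherwise the elements that are
-- neither least nor greatest, at least three of them, form an antichain, and any
-- three of those give a cyclic triple of pairs.
module Submission where

open import Defs
open import Data.Nat using (ℕ; zero; suc; _+_; _≤_; _<_; _≤?_; z≤n; s≤s; z<s)
open import Data.Nat.Properties using (≤-reflexive; ≤-trans; ≤-pred; ≰⇒>; <⇒≱; m<m+n; +-suc)
open import Data.Bool using (Bool; true; false; not; _∧_; b≤b; f≤t; f<t)
  renaming (_≤_ to _≤ᵇ_; _<_ to _<ᵇ_)
open import Data.Bool.Properties using (¬-not; <-irrefl; <-transʳ)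
  renaming (_≟_ to _≟ᵇ_; _≤?_ to _≤ᵇ?_; ≤-refl to ≤ᵇ-refl; ≤-antisym to ≤ᵇ-antisym)
open import Data.Fin using (Fin; zero; suc) renaming (_≟_ to _≟ᶠ_)
open import Data.Fin.Properties using (injective⇒≤; all?; ¬∀⟶∃¬)
open import Data.Fin.Permutation using (Permutation′; _⟨$⟩ʳ_; _⟨$⟩ˡ_; inverseʳ)
open import Data.Vec using (Vec; []; _∷_; lookup; updateAt; zipWith)
open import Data.Vec.Properties using (≡-dec; lookup-zipWith; ∷-injectiveʳ)
open import Data.Vec.Relation.Binary.Pointwise.Extensional using (ext; Pointwise-≡⇒≡)
open import Data.List using (List; []; _∷_; _++_; [_]; length; filter; concatMap; take; map)
import Data.List as List
open import Data.List.Properties using (filter-all; length-map)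
open import Data.List.Membership.Propositional using (_∈_)
open import Data.List.Membership.Propositional.Properties using (∈-filter⁻; ∈-lookup)
open import Data.List.Relation.Unary.Any using (here; there)
open import Data.List.Relation.Unary.All using (All; []; _∷_)
import Data.List.Relation.Unary.All as All
open import Data.List.Relation.Unary.All.Properties using (¬All⇒Any¬; ¬Any⇒All¬)
import Data.List.Relation.Unary.All.Properties as All
open import Data.List.Relation.Unary.AllPairs using (AllPairs; []; _∷_)
import Data.List.Relation.Unary.AllPairs as AllPairs
import Data.List.Relation.Unary.AllPairs.Properties as AllPairs
open import Data.List.Relation.Unary.Unique.Propositional using (Unique)
open import Data.List.Relation.Unary.Unique.Propositional.Properties
  using () renaming (filter⁺ to Unique-filter⁺)
open import Data.Product using (Σ; ∃-syntax; _×_; _,_; proj₁; proj₂)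
open import Data.Sum using (_⊎_; inj₁; inj₂)
open import Data.Unit using (tt)
open import Data.Empty using (⊥)
open import Function using (_∘_)
open import Level using (0ℓ)
open import Function.Bundles using (Equivalence; _⇔_)
open import Function.Definitions using (Injective)
open import Relation.Nullary using (¬_; Dec; yes; no; contradiction)
open import Relation.Unary using (Pred; Decidable; ∁)
open import Relation.Unary.Properties using (∁?)
open import Relation.Binary.PropositionalEquality
  using (_≡_; _≢_; refl; sym; trans; cong; subst; subst₂; ≢-sym)

module _ {A : Set} {P : Pred A 0ℓ} (P? : Decidable P) where

  length≤suc-filter-∁ : ∀ {xs : List A} → Unique xs →
    (∀ {u v} → u ∈ xs → v ∈ xs → P u → P v → u ≡ v) →
    length xs ≤ suc (length (filter (∁? P?) xs))
  length≤suc-filter-∁ {[]} _ _ = z≤n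
  length≤suc-filter-∁ {x ∷ xs} (x∉xs ∷ uniq) P-unique with P? x
  ... | yes px = s≤s (≤-reflexive (cong length (sym (filter-all (∁? P?) others))))
    where
    others : All (∁ P) xs
    others = All.tabulate λ y∈xs py →
      All.lookup x∉xs y∈xs (P-unique (here refl) (there y∈xs) px py)
  ... | no _ = s≤s (length≤suc-filter-∁ uniq λ u∈ v∈ → P-unique (there u∈) (there v∈))

lookup-injective : ∀ {A : Set} {xs : List A} → Unique xs → Injective _≡_ _≡_ (List.lookup xs)
lookup-injective {xs = _ ∷ _} _ {zero} {zero} _ = refl
lookup-injective (x∉xs ∷ _) {zero} {suc j} eq = contradiction eq (All.lookup x∉xs (∈-lookup j))
lookup-injective (x∉xs ∷ _) {suc i} {zero} eq = contradiction (sym eq) (All.lookup x∉xs (∈-lookup i))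
lookup-injective {xs = _ ∷ _} (_ ∷ uniq) {suc i} {suc j} eq = cong suc (lookup-injective uniq eq)

unique-length≤ : ∀ {n} {xs : List (Fin n)} → Unique xs → length xs ≤ n
unique-length≤ uniq = injective⇒≤ (lookup-injective uniq)

module SeparatedAscents {A : Set} {_≼_ : A → A → Set}
  (_≼?_ : ∀ x y → Dec (x ≼ y)) (≼-refl : ∀ x → x ≼ x)
  (≼-antisym : ∀ {x y} → x ≼ y → y ≼ x → x ≡ y) (xs : List A) where

  open import Data.List.Membership.Propositional {A = A} using (find)

  record Ascent : Set where
    constructor ascent
    field
      {low high} : A
      low∈xs : low ∈ xs
      high∈xs : high ∈ xs
      rises : ¬ high ≼ low

  open Ascent

  Separated : Ascent → Ascent → Set
  Separated a b = high a ≼ low b ⊎ high b ≼ low a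

  HasSeparatedAscents : ℕ → Set
  HasSeparatedAscents k = Σ (List Ascent) λ as → length as ≡ k × AllPairs Separated as

  -- The pairs (v₀, v₁), (v₁, v₂), (v₂, v₃); the case v₃ = v₀ is a cyclic triple.
  walk-ascents : ∀ {v₀ v₁ v₂ v₃} → v₀ ∈ xs → v₁ ∈ xs → v₂ ∈ xs → v₃ ∈ xs →
    ¬ v₁ ≼ v₀ → ¬ v₂ ≼ v₁ → ¬ v₃ ≼ v₂ → v₁ ≼ v₂ ⊎ v₃ ≼ v₀ → HasSeparatedAscents 3
  walk-ascents {v₁ = v₁} {v₂} v₀∈ v₁∈ v₂∈ v₃∈ v₁≰v₀ v₂≰v₁ v₃≰v₂ sep₁₃ =
    ascent v₀∈ v₁∈ v₁≰v₀ ∷ ascent v₁∈ v₂∈ v₂≰v₁ ∷ ascent v₂∈ v₃∈ v₃≰v₂ ∷ [] , refl ,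
    (inj₁ (≼-refl v₁) ∷ sep₁₃ ∷ []) ∷ (inj₁ (≼-refl v₂) ∷ []) ∷ [] ∷ []

  Bottom Top : A → Set
  Bottom u = All (u ≼_) xs
  Top u = All (_≼ u) xs

  Middle : A → Set
  Middle u = u ∈ xs × ¬ Bottom u × ¬ Top u

  strict-middle-ascents : ∀ {u v} → Middle u → Middle v → u ≼ v → u ≢ v → HasSeparatedAscents 3
  strict-middle-ascents (u∈ , ¬bottom , _) (v∈ , _ , ¬top) u≼v u≢v =
    let v₀ , v₀∈ , u≰v₀ = find (¬All⇒Any¬ (_ ≼?_) xs ¬bottom)
        v₃ , v₃∈ , v₃≰v = find (¬All⇒Any¬ (_≼? _) xs ¬top)
    in walk-ascents v₀∈ u∈ v∈ v₃∈ u≰v₀ (u≢v ∘ ≼-antisym u≼v) v₃≰v (inj₁ u≼v)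

  middles-ascents : ∀ {ms} → Unique ms → All Middle ms → 3 ≤ length ms → HasSeparatedAscents 3
  middles-ascents {a ∷ b ∷ c ∷ _} ((a≢b ∷ a≢c ∷ _) ∷ (b≢c ∷ _) ∷ _) (ma ∷ mb ∷ mc ∷ _) _
    with b ≼? a | c ≼? b | a ≼? c
  ... | yes b≼a | _       | _       = strict-middle-ascents mb ma b≼a (≢-sym a≢b)
  ... | no _    | yes c≼b | _       = strict-middle-ascents mc mb c≼b (≢-sym b≢c)
  ... | no _    | no _    | yes a≼c = strict-middle-ascents ma mc a≼c a≢c
  ... | no b≰a  | no c≰b  | no a≰c  =
    walk-ascents (proj₁ ma) (proj₁ mb) (proj₁ mc) (proj₁ ma) b≰a c≰b a≰c (inj₂ (≼-refl a))
  middles-ascents {[]}         _ _ ()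
  middles-ascents {_ ∷ []}     _ _ (s≤s ())
  middles-ascents {_ ∷ _ ∷ []} _ _ (s≤s (s≤s ()))

  separated-ascents : Unique xs → 5 ≤ length xs → HasSeparatedAscents 3
  separated-ascents uniq 5≤∣xs∣ =
    middles-ascents (Unique-filter⁺ (∁? Top?) nonBottoms-unique) all-middle
      (≤-pred (≤-pred (≤-trans 5≤∣xs∣ ∣xs∣≤2+∣middles∣)))
    where
    Bottom? : Decidable Bottom
    Bottom? u = All.all? (u ≼?_) xs
    Top? : Decidable Top
    Top? u = All.all? (_≼? u) xs
    nonBottoms middles : List A
    nonBottoms = filter (∁? Bottom?) xs
    middles = filter (∁? Top?) nonBottoms
    nonBottoms-unique : Unique nonBottoms
    nonBottoms-unique = Unique-filter⁺ (∁? Bottom?) uniq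
    bottoms-equal : ∀ {u v} → u ∈ xs → v ∈ xs → Bottom u → Bottom v → u ≡ v
    bottoms-equal u∈ v∈ bu bv = ≼-antisym (All.lookup bu v∈) (All.lookup bv u∈)
    tops-equal : ∀ {u v} → u ∈ nonBottoms → v ∈ nonBottoms → Top u → Top v → u ≡ v
    tops-equal u∈ v∈ tu tv =
      ≼-antisym (All.lookup tv (proj₁ (∈-filter⁻ _ u∈))) (All.lookup tu (proj₁ (∈-filter⁻ _ v∈)))
    ∣xs∣≤2+∣middles∣ : length xs ≤ 2 + length middles
    ∣xs∣≤2+∣middles∣ = ≤-trans (length≤suc-filter-∁ Bottom? uniq bottoms-equal)
      (s≤s (length≤suc-filter-∁ Top? nonBottoms-unique tops-equal))
    all-middle : All Middle middles
    all-middle = All.tabulate λ m∈ →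
      let m∈′ , ¬top = ∈-filter⁻ (∁? Top?) m∈
          m∈xs , ¬bottom = ∈-filter⁻ (∁? Bottom?) m∈′
      in m∈xs , ¬bottom , ¬top

Sensitive : ∀ {k} → (Vec Bool k → Bool) → Fin k → Set
Sensitive h j = ∃[ u ] h u ≢ h (updateAt u j not)

sensitive-coordinate : ∀ {k} (h : Vec Bool k → Bool) (z w : Vec Bool k) → h z ≢ h w →
  ∃[ j ] lookup z j ≢ lookup w j × Sensitive h j
sensitive-coordinate h [] [] hz≢hw = contradiction refl hz≢hw
sensitive-coordinate h (a ∷ z) (b ∷ w) hz≢hw with h (a ∷ z) ≟ᵇ h (a ∷ w)
... | no tail-matters =
  let j , zj≢wj , u , hu≢ = sensitive-coordinate (h ∘ (a ∷_)) z w tail-matters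
  in suc j , zj≢wj , a ∷ u , hu≢
... | yes same-tail =
  zero , a≢b , a ∷ w , subst (λ c → h (a ∷ w) ≢ h (c ∷ w)) (¬-not (≢-sym a≢b)) head-matters
  where
  head-matters : h (a ∷ w) ≢ h (b ∷ w)
  head-matters = hz≢hw ∘ trans same-tail
  a≢b : a ≢ b
  a≢b refl = head-matters refl

∧-≤ʳ : ∀ a b → a ∧ b ≤ᵇ b
∧-≤ʳ false false = b≤b
∧-≤ʳ false true  = f≤t
∧-≤ʳ true  _     = b≤b

≢∧⇒> : ∀ {a b} → a ≢ a ∧ b → b <ᵇ a
≢∧⇒> {false}         a≢ = contradiction refl a≢
≢∧⇒> {true}  {false} _  = f<t
≢∧⇒> {true}  {true}  a≢ = contradiction refl a≢

≰ᵇ⇒> : ∀ {a b} → ¬ a ≤ᵇ b → b <ᵇ a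
≰ᵇ⇒> {false} {false} a≰b = contradiction b≤b a≰b
≰ᵇ⇒> {false} {true}  a≰b = contradiction f≤t a≰b
≰ᵇ⇒> {true}  {false} _   = f<t
≰ᵇ⇒> {true}  {true}  a≰b = contradiction b≤b a≰b

module _ {n : ℕ} where

  ≤ᵛ-refl : (x : Vec Bool n) → x ≤ᵛ x
  ≤ᵛ-refl _ _ = ≤ᵇ-refl

  ≤ᵛ-antisym : {x y : Vec Bool n} → x ≤ᵛ y → y ≤ᵛ x → x ≡ y
  ≤ᵛ-antisym x≤y y≤x = Pointwise-≡⇒≡ (ext λ i → ≤ᵇ-antisym (x≤y i) (y≤x i))

  _≤ᵛ?_ : (x y : Vec Bool n) → Dec (x ≤ᵛ y)
  x ≤ᵛ? y = all? λ i → lookup x i ≤ᵇ? lookup y i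

  Rise : Vec Bool n → Vec Bool n → Fin n → Set
  Rise x y i = lookup x i <ᵇ lookup y i

  ≰ᵛ⇒rise : {x y : Vec Bool n} → ¬ y ≤ᵛ x → ∃[ i ] Rise x y i
  ≰ᵛ⇒rise {x = x} {y = y} y≰x =
    let i , yi≰xi = ¬∀⟶∃¬ n _ (λ i → lookup y i ≤ᵇ? lookup x i) y≰x in i , ≰ᵇ⇒> yi≰xi

  rises-disjoint : (x y z w : Vec Bool n) {i : Fin n} → y ≤ᵛ z → Rise x y i → Rise z w i → ⊥
  rises-disjoint _ _ _ _ {i} y≤z = absurd (y≤z i)
    where
    absurd : ∀ {a b c d} → b ≤ᵇ c → a <ᵇ b → c <ᵇ d → ⊥
    absurd () f<t f<t

  rise-has-rising-regulator : {f : BN n} → Monotone f → {x y : Vec Bool n} {i : Fin n} →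
    f x ≡ x → f y ≡ y → Rise x y i → ∃[ j ] Rise x y j × DependsOn f j i
  rise-has-rising-regulator {f} mono {x} {y} {i} fx≡x fy≡y xi<yi =
    let j , yj≢mj , sensitive = sensitive-coordinate fᵢ y meet (λ e → <-irrefl (sym e) fᵢmeet<fᵢy)
    in j , ≢∧⇒> (subst (lookup y j ≢_) (lookup-zipWith _∧_ j y x) yj≢mj) , sensitive
    where
    meet : Vec Bool n
    meet = zipWith _∧_ y x
    fᵢ : Vec Bool n → Bool
    fᵢ v = lookup (f v) i
    meet≤x : meet ≤ᵛ x
    meet≤x j =
      subst (_≤ᵇ lookup x j) (sym (lookup-zipWith _∧_ j y x)) (∧-≤ʳ (lookup y j) (lookup x j))
    fᵢmeet<fᵢy : fᵢ meet <ᵇ fᵢ y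
    fᵢmeet<fᵢy = <-transʳ (mono meet x meet≤x i)
      (subst₂ _<ᵇ_ (cong (λ v → lookup v i) (sym fx≡x)) (cong (λ v → lookup v i) (sym fy≡y)) xi<yi)

allConfigs-unique : ∀ n → Unique (allConfigs n)
allConfigs-unique zero = [] ∷ []
allConfigs-unique (suc n) = extend-unique (allConfigs-unique n)
  where
  extend : List (Vec Bool n) → List (Vec Bool (suc n))
  extend = concatMap λ x → (false ∷ x) ∷ (true ∷ x) ∷ []
  ∉-extend : ∀ {x : Vec Bool n} {b} {xs} → All (x ≢_) xs → All ((b ∷ x) ≢_) (extend xs)
  ∉-extend [] = []
  ∉-extend (x≢y ∷ x∉xs) = x≢y ∘ ∷-injectiveʳ ∷ x≢y ∘ ∷-injectiveʳ ∷ ∉-extend x∉xs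
  extend-unique : ∀ {xs} → Unique xs → Unique (extend xs)
  extend-unique [] = []
  extend-unique (x∉xs ∷ uniq) = ((λ ()) ∷ ∉-extend x∉xs) ∷ ∉-extend x∉xs ∷ extend-unique uniq

module _ {n} (G : Digraph n) where

  open import Data.List.Membership.DecPropositional (_≟ᶠ_ {n}) using (_∈?_)

  CycleWithin : Pred (Fin n) 0ℓ → Set
  CycleWithin P = Σ (Cycle G) λ c → All P (vertices c)

  chain-prefix : ∀ {u z w ws} → u ∈ w ∷ ws → Chain G (w ∷ ws) → Arc G u z →
    ∃[ k ] Chain G (w ∷ take k ws ++ [ z ])
  chain-prefix (here refl) _ u→z = 0 , u→z , tt
  chain-prefix {ws = _ ∷ _} (there u∈) (w→w′ , chain) u→z =
    let k , chain′ = chain-prefix u∈ chain u→z in suc k , w→w′ , chain′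

  cycle-within : ∀ {P} → (∀ {v} → P v → ∃[ u ] P u × Arc G u v) → ∀ {v} → P v → CycleWithin P
  cycle-within {P} in-neighbour pv = extend n _ [] (m<m+n n z<s) ([] ∷ []) (pv ∷ []) tt
    where
    -- A path inside P is extended backwards until an in-neighbour closes a cycle; a
    -- simple path has at most n vertices, so n steps suffice.
    extend : ∀ fuel w ws → n < fuel + length (w ∷ ws) →
      Unique (w ∷ ws) → All P (w ∷ ws) → Chain G (w ∷ ws) → CycleWithin P
    extend zero _ _ n<∣path∣ uniq _ _ = contradiction (unique-length≤ uniq) (<⇒≱ n<∣path∣)
    extend (suc fuel) w ws n<∣path∣ uniq inP chain with in-neighbour (All.head inP)
    ... | u , pu , u→w with u ∈? w ∷ ws
    ... | yes u∈path =
      let k , closed = chain-prefix u∈path chain u→w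
      in record { start = w ; rest = take k ws ; unique = AllPairs.take⁺ (suc k) uniq ; closed = closed }
         , All.take⁺ (suc k) inP
    ... | no u∉path =
      extend fuel u (w ∷ ws) (subst (n <_) (sym (+-suc fuel _)) n<∣path∣)
        (¬Any⇒All¬ _ u∉path ∷ uniq) (pu ∷ inP) (u→w , chain)

fixed? : ∀ {n} (f : BN n) → Decidable (λ x → f x ≡ x)
fixed? f x = ≡-dec _≟ᵇ_ (f x) x

fixedPoints : ∀ {n} → BN n → List (Vec Bool n)
fixedPoints {n} f = filter (fixed? f) (allConfigs n)

module _ {n} {G : Digraph n} {f : BN n} (mono : Monotone f) (σ : Permutation′ n)
  (iso : ∀ u v → Arc G u v ⇔ DependsOn f (σ ⟨$⟩ʳ u) (σ ⟨$⟩ʳ v)) where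

  open SeparatedAscents _≤ᵛ?_ ≤ᵛ-refl ≤ᵛ-antisym (fixedPoints f)
  open Ascent

  RiseInG : Vec Bool n → Vec Bool n → Fin n → Set
  RiseInG x y v = Rise x y (σ ⟨$⟩ʳ v)

  rise-cycle : ∀ {x y} → f x ≡ x → f y ≡ y → ¬ y ≤ᵛ x → CycleWithin G (RiseInG x y)
  rise-cycle {x} {y} fx≡x fy≡y y≰x =
    cycle-within G in-neighbour (relabel {Rise x y} (proj₂ (≰ᵛ⇒rise {x = x} {y = y} y≰x)))
    where
    relabel : ∀ {Q : Fin n → Set} {i} → Q i → Q (σ ⟨$⟩ʳ (σ ⟨$⟩ˡ i))
    relabel {Q} = subst Q (sym (inverseʳ σ))
    in-neighbour : ∀ {v} → RiseInG x y v → ∃[ u ] RiseInG x y u × Arc G u v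
    in-neighbour {v} rise =
      let j , rise′ , j→v = rise-has-rising-regulator mono {x = x} {y = y} fx≡x fy≡y rise
      in σ ⟨$⟩ˡ j , relabel {Rise x y} rise′ ,
         Equivalence.from (iso _ v) (relabel {λ k → DependsOn f k (σ ⟨$⟩ʳ v)} j→v)

  ascent-cycle : (a : Ascent) → CycleWithin G (RiseInG (low a) (high a))
  ascent-cycle a = rise-cycle (fixed (low∈xs a)) (fixed (high∈xs a)) (rises a)
    where
    fixed : ∀ {x} → x ∈ fixedPoints f → f x ≡ x
    fixed = proj₂ ∘ ∈-filter⁻ (fixed? f) {xs = allConfigs n}

  rise-at : ∀ a {v} → v ∈ vertices (proj₁ (ascent-cycle a)) → RiseInG (low a) (high a) v
  rise-at a = All.lookup (proj₂ (ascent-cycle a))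

  separated⇒disjoint : ∀ {a b} → Separated a b →
    VertexDisjoint (proj₁ (ascent-cycle a)) (proj₁ (ascent-cycle b))
  separated⇒disjoint {a} {b} (inj₁ ha≤lb) _ v∈a v∈b =
    rises-disjoint (low a) (high a) (low b) (high b) ha≤lb (rise-at a v∈a) (rise-at b v∈b)
  separated⇒disjoint {a} {b} (inj₂ hb≤la) _ v∈a v∈b =
    rises-disjoint (low b) (high b) (low a) (high a) hb≤la (rise-at b v∈b) (rise-at a v∈a)

  disjoint-cycles : ∀ {k} → HasSeparatedAscents k → HasDisjointCycles G k
  disjoint-cycles (as , refl , separated) =
    map (proj₁ ∘ ascent-cycle) as , length-map _ as ,
    AllPairs.map⁺ (AllPairs.map (λ {a} {b} → separated⇒disjoint {a} {b}) separated)

  five-fixed-points⇒three-disjoint-cycles : 5 ≤ length (fixedPoints f) → HasDisjointCycles G 3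
  five-fixed-points⇒three-disjoint-cycles =
    disjoint-cycles ∘ separated-ascents (Unique-filter⁺ _ (allConfigs-unique n))

proposition4 : (n : ℕ) (G : Digraph n) → ν≤ G 2 →
    (f : BN n) → Monotone f → IGIsomorphic f G → numFixedPoints f ≤ 4
proposition4 n G ν≤2 f mono (σ , iso) with numFixedPoints f ≤? 4
... | yes ≤4 = ≤4
... | no ≰4 = contradiction (five-fixed-points⇒three-disjoint-cycles mono σ iso (≰⇒> ≰4)) ν≤2
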